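{- Let $N$ be an SF-normal form (an SF-term admitting no $\rightarrow_{\mathrm{SF}}$ step). Then $[\![N]\!]_{@}$ is strongly normalising with respect to $\rightarrow_{\mathrm{SF}^{\mathcal{C}}_{@}}$.
   Context: SF-calculus: terms are given by $M, N ::= \mathbf{S} \mid \mathbf{F} \mid M\,N$ (application, left-associative; no variables). Terms of the form $\mathbf{S}$, $\mathbf{F}$, $\mathbf{S}\,M$, $\mathbf{F}\,M$, $\mathbf{S}\,M\,N$, $\mathbf{F}\,M\,N$ are called factorable forms. The one-step reduction $\rightarrow_{\mathrm{SF}}$ is the smallest relation closed under term contexts satisfying: $\mathbf{S}\,M\,N\,X \rightarrow_{\mathrm{SF}} M\,X\,(N\,X)$; $\mathbf{F}\,O\,M\,N \rightarrow_{\mathrm{SF}} M$ if $O$ is $\mathbf{S}$ or $\mathbf{F}$; $\mathbf{F}\,(P\,Q)\,M\,N \rightarrow_{\mathrm{SF}} N\,P\,Q$ if $P\,Q$ is a factorable form. Curryfied applicative SF-calculus $\mathrm{SF}^{\mathcal{C}}_{@}$: the first-order term rewriting system over the signature with constructors $\mathbf{S}_0,\mathbf{F}_0$ (arity 0), $\mathbf{S}_1,\mathbf{F}_1$ (arity 1), $\mathbf{S}_2,\mathbf{F}_2$ (arity 2), and program symbols $\mathsf{app}$ (arity 2) and $\mathsf{fred}$ (arity 3), with rewrite rules $\mathsf{app}(\mathbf{S}_0,x)\to\mathbf{S}_1(x)$; $\mathsf{app}(\mathbf{S}_1(x),y)\to\mathbf{S}_2(x,y)$; $\mathsf{app}(\mathbf{S}_2(x,y),z)\to\mathsf{app}(\mathsf{app}(x,z),\mathsf{app}(y,z))$;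 $\mathsf{app}(\mathbf{F}_0,x)\to\mathbf{F}_1(x)$; $\mathsf{app}(\mathbf{F}_1(x),y)\to\mathbf{F}_2(x,y)$; $\mathsf{app}(\mathbf{F}_2(x,y),z)\to\mathsf{fred}(x,y,z)$; $\mathsf{fred}(\mathbf{S}_0,y,z)\to y$; $\mathsf{fred}(\mathbf{F}_0,y,z)\to y$; $\mathsf{fred}(\mathbf{S}_1(x),y,z)\to\mathsf{app}(\mathsf{app}(z,\mathbf{S}_0),x)$; $\mathsf{fred}(\mathbf{F}_1(x),y,z)\to\mathsf{app}(\mathsf{app}(z,\mathbf{F}_0),x)$; $\mathsf{fred}(\mathbf{S}_2(p,q),y,z)\to\mathsf{app}(\mathsf{app}(z,\mathsf{app}(\mathbf{S}_0,p)),q)$; $\mathsf{fred}(\mathbf{F}_2(p,q),y,z)\to\mathsf{app}(\mathsf{app}(z,\mathsf{app}(\mathbf{F}_0,p)),q)$. Its one-step reduction $\rightarrow_{\mathrm{SF}^{\mathcal{C}}_{@}}$ is the closure of these rules under substitution and contexts. A term is strongly normalising if it has no infinite reduction sequence. The translation $[\![\cdot]\!]_{@}$: $[\![\mathbf{S}]\!]_{@}=\mathbf{S}_0$, $[\![\mathbf{F}]\!]_{@}=\mathbf{F}_0$, $[\![M\,N]\!]_{@}=\mathsf{app}([\![M]\!]_{@},[\![N]\!]_{@})$. -}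

module Defs where

open import Data.Product using (∃; _,_)
open import Relation.Nullary using (¬_)
open import Induction.WellFounded using (Acc)

infixl 9 _·_

data SF : Set where
  S F : SF
  _·_ : SF → SF → SF

data IsAtom : SF → Set where
  atomS : IsAtom S
  atomF : IsAtom F

data Factorable : SF → Set where
  fS   : Factorable S
  fF   : Factorable F
  fSM  : ∀ M → Factorable (S · M)
  fFM  : ∀ M → Factorable (F · M)
  fSMN : ∀ M N → Factorable (S · M · N)
  fFMN : ∀ M N → Factorable (F · M · N)

data _→SF_ : SF → SF → Set where
  S-rule  : ∀ M N X → (S · M · N · X) →SF (M · X · (N · X))
  F-atom  : ∀ O M N → IsAtom O → (F · O · M · N) →SF M
  F-comp  : ∀ P Q M N → Factorable (P · Q) → (F · (P · Q) · M · N) →SF (N · P · Q)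
  appL    : ∀ {M M'} N → M →SF M' → (M · N) →SF (M' · N)
  appR    : ∀ M {N N'} → N →SF N' → (M · N) →SF (M · N')

SF-normal : SF → Set
SF-normal M = ¬ (∃ λ M' → M →SF M')

-- Curryfied applicative SF-calculus (first-order TRS), ground terms

data Tm : Set where
  S₀ F₀ : Tm
  S₁ F₁ : Tm → Tm
  S₂ F₂ : Tm → Tm → Tm
  app   : Tm → Tm → Tm
  fred  : Tm → Tm → Tm → Tm

data _↦_ : Tm → Tm → Set where
  r-S0 : ∀ x → app S₀ x ↦ S₁ x
  r-S1 : ∀ x y → app (S₁ x) y ↦ S₂ x y
  r-S2 : ∀ x y z → app (S₂ x y) z ↦ app (app x z) (app y z)
  r-F0 : ∀ x → app F₀ x ↦ F₁ x
  r-F1 : ∀ x y → app (F₁ x) y ↦ F₂ x y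
  r-F2 : ∀ x y z → app (F₂ x y) z ↦ fred x y z
  f-S0 : ∀ y z → fred S₀ y z ↦ y
  f-F0 : ∀ y z → fred F₀ y z ↦ y
  f-S1 : ∀ x y z → fred (S₁ x) y z ↦ app (app z S₀) x
  f-F1 : ∀ x y z → fred (F₁ x) y z ↦ app (app z F₀) x
  f-S2 : ∀ p q y z → fred (S₂ p q) y z ↦ app (app z (app S₀ p)) q
  f-F2 : ∀ p q y z → fred (F₂ p q) y z ↦ app (app z (app F₀ p)) q

data _⟶_ : Tm → Tm → Set where
  root   : ∀ {s t} → s ↦ t → s ⟶ t
  S₁-c   : ∀ {s t} → s ⟶ t → S₁ s ⟶ S₁ t
  F₁-c   : ∀ {s t} → s ⟶ t → F₁ s ⟶ F₁ t
  S₂-c₁  : ∀ {s t} u → s ⟶ t → S₂ s u ⟶ S₂ t u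
  S₂-c₂  : ∀ u {s t} → s ⟶ t → S₂ u s ⟶ S₂ u t
  F₂-c₁  : ∀ {s t} u → s ⟶ t → F₂ s u ⟶ F₂ t u
  F₂-c₂  : ∀ u {s t} → s ⟶ t → F₂ u s ⟶ F₂ u t
  app-c₁ : ∀ {s t} u → s ⟶ t → app s u ⟶ app t u
  app-c₂ : ∀ u {s t} → s ⟶ t → app u s ⟶ app u t
  fred-c₁ : ∀ {s t} u v → s ⟶ t → fred s u v ⟶ fred t u v
  fred-c₂ : ∀ u {s t} v → s ⟶ t → fred u s v ⟶ fred u t v
  fred-c₃ : ∀ u v {s t} → s ⟶ t → fred u v s ⟶ fred u v t

_⟵_ : Tm → Tm → Set
t ⟵ s = s ⟶ t

SN : Tm → Set
SN t = Acc _⟵_ t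

⟦_⟧ₐ : SF → Tm
⟦ S ⟧ₐ = S₀
⟦ F ⟧ₐ = F₀
⟦ M · N ⟧ₐ = app ⟦ M ⟧ₐ ⟦ N ⟧ₐ

-- An SF-normal form N is built from factorable forms all the way down:
-- N is S or F applied to at most two arguments, each again normal.  Its
-- translation ⟦ N ⟧ₐ is therefore a "curried form": an operator S₀/F₀ fed
-- to at most two arguments through app (or already absorbed into S₁/F₁/S₂/F₂),
-- all arguments being curried forms again.  In such a term the only redexes
-- are the currying rules app S₀ x ↦ S₁ x, app (S₁ x) y ↦ S₂ x y (and their F
-- variants); the rules for app (S₂ x y) z and app (F₂ x y) z never apply,
-- since a form never has more than two arguments.  Each currying step keeps
-- the term a curried form and erases one app symbol.
module Submission where

open import Defs
open import Data.Nat using (ℕ; suc; _+_; _<_; s≤s)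
open import Data.Nat.Properties using (n<1+n; +-monoˡ-<; +-monoʳ-<)
open import Data.Nat.Induction using (<-wellFounded)
open import Data.Product using (Σ; _,_; _×_)
open import Data.Empty using (⊥-elim)
open import Function using (flip)
open import Induction.WellFounded using (Acc; acc)

terminates-by-measure :
  {A : Set} {_⇒_ : A → A → Set} (P : A → Set) (μ : A → ℕ) →
  (∀ {a b} → P a → a ⇒ b → P b × μ b < μ a) →
  ∀ {a} → P a → Acc (flip _⇒_) a
terminates-by-measure {_⇒_ = _⇒_} P μ step {a} p = go (<-wellFounded (μ a)) p
  where
  go : ∀ {a} → Acc _<_ (μ a) → P a → Acc (flip _⇒_) a
  go (acc rec) p = acc λ s → let (p′ , decreases) = step p s in go (rec decreases) p′

-- Number of arguments an operator S/F has received in a curried form.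
data Args : Set where
  none one two : Args

data Form : Args → Tm → Set

CurriedForm : Tm → Set
CurriedForm t = Σ Args λ k → Form k t

data Form where
  S₀-form : Form none S₀
  F₀-form : Form none F₀
  S₁-form : ∀ {x} → CurriedForm x → Form one (S₁ x)
  F₁-form : ∀ {x} → CurriedForm x → Form one (F₁ x)
  app₁-form : ∀ {f x} → Form none f → CurriedForm x → Form one (app f x)
  S₂-form : ∀ {x y} → CurriedForm x → CurriedForm y → Form two (S₂ x y)
  F₂-form : ∀ {x y} → CurriedForm x → CurriedForm y → Form two (F₂ x y)
  app₂-form : ∀ {f y} → Form one f → CurriedForm y → Form two (app f y)

#app : Tm → ℕ
#app S₀ = 0
#app F₀ = 0
#app (S₁ t) = #app t
#app (F₁ t) = #app t
#app (S₂ a b) = #app a + #app b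
#app (F₂ a b) = #app a + #app b
#app (app a b) = suc (#app a + #app b)
#app (fred a b c) = #app a + #app b + #app c

no-step-without-arguments : ∀ {f u} → Form none f → f ⟶ u → ∀ {A : Set} → A
no-step-without-arguments S₀-form (root ())
no-step-without-arguments F₀-form (root ())

-- Subject reduction for curried forms: a step keeps the number of arguments
-- and removes an app symbol (root steps are currying steps, inner steps
-- decrease the measure of a subterm).
form-step : ∀ {k t u} → Form k t → t ⟶ u → Form k u × #app u < #app t
curried-form-step : ∀ {t u} → CurriedForm t → t ⟶ u → CurriedForm u × #app u < #app t
curried-form-step (k , t-form) s = let (u-form , lt) = form-step t-form s in (k , u-form) , lt

form-step S₀-form (root ())
form-step F₀-form (root ())
form-step (S₁-form x) (S₁-c s) = let (x′ , lt) = curried-form-step x s in S₁-form x′ , lt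
form-step (F₁-form x) (F₁-c s) = let (x′ , lt) = curried-form-step x s in F₁-form x′ , lt
form-step (app₁-form S₀-form x) (root (r-S0 _)) = S₁-form x , n<1+n _
form-step (app₁-form F₀-form x) (root (r-F0 _)) = F₁-form x , n<1+n _
form-step (app₁-form f x) (app-c₁ _ s) = no-step-without-arguments f s
form-step (app₁-form {f} f-form x) (app-c₂ _ s) =
  let (x′ , lt) = curried-form-step x s in app₁-form f-form x′ , +-monoʳ-< (suc (#app f)) lt
form-step (S₂-form {y = y} x y-form) (S₂-c₁ _ s) =
  let (x′ , lt) = curried-form-step x s in S₂-form x′ y-form , +-monoˡ-< (#app y) lt
form-step (S₂-form {x} x-form y) (S₂-c₂ _ s) =
  let (y′ , lt) = curried-form-step y s in S₂-form x-form y′ , +-monoʳ-< (#app x) lt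
form-step (F₂-form {y = y} x y-form) (F₂-c₁ _ s) =
  let (x′ , lt) = curried-form-step x s in F₂-form x′ y-form , +-monoˡ-< (#app y) lt
form-step (F₂-form {x} x-form y) (F₂-c₂ _ s) =
  let (y′ , lt) = curried-form-step y s in F₂-form x-form y′ , +-monoʳ-< (#app x) lt
form-step (app₂-form (S₁-form x) y) (root (r-S1 _ _)) = S₂-form x y , n<1+n _
form-step (app₂-form (F₁-form x) y) (root (r-F1 _ _)) = F₂-form x y , n<1+n _
form-step (app₂-form (app₁-form _ _) _) (root ())
form-step (app₂-form {y = y} f y-form) (app-c₁ _ s) =
  let (f′ , lt) = form-step f s in app₂-form f′ y-form , s≤s (+-monoˡ-< (#app y) lt)
form-step (app₂-form {f} f-form y) (app-c₂ _ s) =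
  let (y′ , lt) = curried-form-step y s in app₂-form f-form y′ , +-monoʳ-< (suc (#app f)) lt

curried-form-SN : ∀ {t} → CurriedForm t → SN t
curried-form-SN = terminates-by-measure CurriedForm #app curried-form-step

normal-left : ∀ {M K} → SF-normal (M · K) → SF-normal M
normal-left {K = K} normal (M′ , s) = normal (M′ · K , appL K s)

normal-right : ∀ {M K} → SF-normal (M · K) → SF-normal K
normal-right {M} normal (K′ , s) = normal (M · K′ , appR M s)

-- Every SF-normal form is factorable: an operator applied to three or more
-- arguments always has a root redex (F with a non-atomic first argument uses
-- that this argument, being normal, is itself factorable).
normal⇒factorable : ∀ N → SF-normal N → Factorable N
normal⇒factorable S _ = fS
normal⇒factorable F _ = fF
normal⇒factorable (M · K) normal with normal⇒factorable M (normal-left normal)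
... | fS = fSM K
... | fF = fFM K
... | fSM A = fSMN A K
... | fFM A = fFMN A K
... | fSMN A B = ⊥-elim (normal (_ , S-rule A B K))
... | fFMN S B = ⊥-elim (normal (_ , F-atom S B K atomS))
... | fFMN F B = ⊥-elim (normal (_ , F-atom F B K atomF))
... | fFMN (P · Q) B =
  ⊥-elim (normal (_ , F-comp P Q B K (normal⇒factorable (P · Q) (normal-right (normal-left (normal-left normal))))))

normal⇒curried-form : ∀ N → SF-normal N → CurriedForm ⟦ N ⟧ₐ
normal⇒curried-form N normal with normal⇒factorable N normal
... | fS = none , S₀-form
... | fF = none , F₀-form
... | fSM M = one , app₁-form S₀-form (normal⇒curried-form M (normal-right normal))
... | fFM M = one , app₁-form F₀-form (normal⇒curried-form M (normal-right normal))
... | fSMN M K = two , app₂-form (app₁-form S₀-form (normal⇒curried-form M (normal-right (normal-left normal))))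
                                 (normal⇒curried-form K (normal-right normal))
... | fFMN M K = two , app₂-form (app₁-form F₀-form (normal⇒curried-form M (normal-right (normal-left normal))))
                                 (normal⇒curried-form K (normal-right normal))

mainTheorem2 : (N : SF) → SF-normal N → SN ⟦ N ⟧ₐ
mainTheorem2 N normal = curried-form-SN (normal⇒curried-form N normal)
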